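{- Let $s$ and $t$ be odd integers. For every integer $k\ge0$, $\nu(\{3k+1\})=\nu(\{3k+2\})=0$. For every integer $k\ge1$, $$\nu(\{3k\})=\begin{cases}1+\delta_E(k)\bigl(\nu(k\{6\})-2\bigr) & \text{if } t\equiv1 \pmod 4,\\ \nu(k\{3\}) & \text{if } t\equiv 3\pmod 4.\end{cases}$$
   Context: For integers $s,t$, let $\{n\}=\{n\}_{s,t}$ be defined by $\{0\}=0$, $\{1\}=1$, $\{n\}=s\{n-1\}+t\{n-2\}$ for $n\ge2$ (so $\{3\}=s^2+t$, $\{6\}=s^5+4s^3t+3st^2$). $\nu=\nu_2$ is the $2$-adic valuation: $\nu(m)$ is the exponent of the highest power of $2$ dividing the integer $m\neq0$, and $\nu(0)=\infty$. $E$ denotes the set of even integers and $\delta_E(k)=1$ if $k\in E$, $0$ otherwise. -}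

module Defs where

open import Data.Nat as ℕ using (ℕ; zero; suc)
open import Data.Integer as ℤ using (ℤ; +_; ∣_∣; _*_; _%ℕ_; _/ℕ_)
open import Data.Bool using (Bool; true; false; if_then_else_)
open import Relation.Nullary.Decidable using (⌊_⌋)

lucas : ℤ → ℤ → ℕ → ℤ
lucas s t zero = + 0
lucas s t (suc zero) = + 1
lucas s t (suc (suc n)) = s ℤ.* lucas s t (suc n) ℤ.+ t ℤ.* lucas s t n

data ℤ∞ : Set where
  fin : ℤ → ℤ∞
  ∞   : ℤ∞

_+∞_ : ℤ∞ → ℤ∞ → ℤ∞
fin a +∞ fin b = fin (a ℤ.+ b)
_     +∞ _     = ∞

-- multiplication by an integer coefficient (used for δ_E(k)·x); 0·∞ = 0
_·∞_ : ℤ → ℤ∞ → ℤ∞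
c ·∞ fin a = fin (c ℤ.* a)
(+ zero) ·∞ ∞ = fin (+ 0)
c ·∞ ∞ = ∞

-- 2-adic valuation with fuel; fuel ∣m∣ suffices for m ≠ 0.
ν-aux : ℕ → ℤ → ℤ∞
ν-aux _ (+ zero) = ∞
ν-aux zero m = fin (+ 0)
ν-aux (suc f) m with m %ℕ 2
... | zero = fin (+ 1) +∞ ν-aux f (m /ℕ 2)
... | suc _ = fin (+ 0)

ν : ℤ → ℤ∞
ν m = ν-aux ∣ m ∣ m

δE : ℕ → ℤ
δE k with k ℕ.% 2
... | zero = + 1
... | suc _ = + 0

-- Trisection: {3k}_{s,t} = {3}_{s,t} · {k}_{A,B} with A = s³ + 3st and B = t³, and bisection:
-- {2k}_{a,b} = a · {k}_{a²+2b,−b²}.  When a ≡ 2 (mod 4) and b is odd, bisection reproduces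
-- these congruences, so induction on k gives ν({k}_{a,b}) = ν(k).  For t ≡ 3 (mod 4) the
-- trisected sequence has A ≡ 2 (mod 4), whence ν({3k}) = ν({3}) + ν(k).  For t ≡ 1 (mod 4)
-- one has 4 ∣ A and ν({3}) = 1; odd k give odd {k}_{A,B}, while for k = 2m bisecting once more
-- yields {6m} = {6} · {m}_{A²+2B,−B²} with A² + 2B ≡ 2 (mod 4).  The terms {3k+1}, {3k+2} are
-- odd because for odd s, t the sequence is periodic mod 2 with pattern 0, 1, 1.
module Submission where

open import Defs
open import Data.Nat as ℕ using (ℕ; zero; suc; z≤n; s≤s)
import Data.Nat.Properties as ℕ
open import Data.Nat.Induction using (<-wellFounded; <-rec)
open import Data.Nat.DivMod using ([m+kn]%n≡m%n; m*n%n≡0)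
open import Data.Integer as ℤ using (ℤ; +_; -_; +[1+_]; -[1+_]; _%ℕ_; _/ℕ_; _+_; _-_; _*_; ∣_∣)
import Data.Integer.Properties as ℤ
open import Data.Integer.DivMod using (a≡a%ℕn+[a/ℕn]*n; n%ℕd<d)
open import Data.Integer.Tactic.RingSolver using (solve; solve-∀)
open import Algebra.Properties.CommutativeSemigroup ℤ.*-commutativeSemigroup using (interchange)
open import Data.List using ([]; _∷_)
open import Data.Product using (_×_; _,_; proj₁; proj₂; ∃-syntax)
open import Data.Sum using (_⊎_; inj₁; inj₂)
open import Data.Empty using (⊥-elim)
open import Function using (_∘_)
open import Induction.WellFounded using (Acc; acc)
open import Relation.Nullary using (¬_; yes; no)
open import Relation.Binary.PropositionalEquality
  using (_≡_; _≢_; refl; sym; trans; cong; cong₂; subst; module ≡-Reasoning)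
open ≡-Reasoning

private variable
  a b s t x y : ℤ
  e f : ℕ

record Even (x : ℤ) : Set where
  constructor even
  field
    half : ℤ
    x≡   : x ≡ + 2 * half

record Odd (x : ℤ) : Set where
  constructor odd
  field
    half : ℤ
    x≡   : x ≡ + 1 + + 2 * half

even+even : Even x → Even y → Even (x + y)
even+even (even p refl) (even q refl) = even (p + q) (solve (p ∷ q ∷ []))

even+odd : Even x → Odd y → Odd (x + y)
even+odd (even p refl) (odd q refl) = odd (p + q) (solve (p ∷ q ∷ []))

odd+even : Odd x → Even y → Odd (x + y)
odd+even (odd p refl) (even q refl) = odd (p + q) (solve (p ∷ q ∷ []))

odd+odd : Odd x → Odd y → Even (x + y)
odd+odd (odd p refl) (odd q refl) = even (+ 1 + p + q) (solve (p ∷ q ∷ []))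

even*ˡ : Even x → ∀ y → Even (x * y)
even*ˡ (even p refl) y = even (p * y) (solve (p ∷ y ∷ []))

even*ʳ : ∀ x → Even y → Even (x * y)
even*ʳ x (even q refl) = even (x * q) (solve (x ∷ q ∷ []))

odd*odd : Odd x → Odd y → Odd (x * y)
odd*odd (odd p refl) (odd q refl) = odd (p + q + + 2 * p * q) (solve (p ∷ q ∷ []))

-odd : Odd x → Odd (- x)
-odd (odd q refl) = odd (- q - + 1) (solve (q ∷ []))

even⇒¬odd : Even x → ¬ Odd x
even⇒¬odd (even p refl) (odd q 2p≡1+2q) with ℕ.m*n≡1⇒m≡1 2 ∣ p - q ∣ 2∣p-q∣≡1
  where
  2∣p-q∣≡1 : 2 ℕ.* ∣ p - q ∣ ≡ 1
  2∣p-q∣≡1 = trans (sym (ℤ.abs-* (+ 2) (p - q))) (cong ∣_∣ (begin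
    + 2 * (p - q)             ≡⟨ solve (p ∷ q ∷ []) ⟩
    + 2 * p - + 2 * q         ≡⟨ cong (_- + 2 * q) 2p≡1+2q ⟩
    + 1 + + 2 * q - + 2 * q   ≡⟨ solve (q ∷ []) ⟩
    + 1                       ∎))
... | ()

odd⇒≢0 : Odd x → x ≢ + 0
odd⇒≢0 x-odd refl = even⇒¬odd (even (+ 0) refl) x-odd

≡%ℕ+*/ℕ : ∀ x n .{{_ : ℕ.NonZero n}} → x ≡ + (x %ℕ n) + + n * (x /ℕ n)
≡%ℕ+*/ℕ x n = trans (a≡a%ℕn+[a/ℕn]*n x n) (cong (_+_ (+ (x %ℕ n))) (ℤ.*-comm (x /ℕ n) (+ n)))

%ℕ≡⇒≡+* : ∀ {x n r} .{{_ : ℕ.NonZero n}} → x %ℕ n ≡ r → x ≡ + r + + n * (x /ℕ n)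
%ℕ≡⇒≡+* {x} {n} x%n≡r = trans (≡%ℕ+*/ℕ x n) (cong (λ r → + r + + n * (x /ℕ n)) x%n≡r)

%ℕ2-cases : ∀ x → (x %ℕ 2 ≡ 0 × x ≡ + 2 * (x /ℕ 2))
              ⊎ (x %ℕ 2 ≡ 1 × x ≡ + 1 + + 2 * (x /ℕ 2))
%ℕ2-cases x with x %ℕ 2 | n%ℕd<d x 2 | ≡%ℕ+*/ℕ x 2
... | 0           | _            | x≡ = inj₁ (refl , trans x≡ (ℤ.+-identityˡ _))
... | 1           | _            | x≡ = inj₂ (refl , x≡)
... | suc (suc _) | s≤s (s≤s ()) | _

even⊎odd : ∀ x → Even x ⊎ Odd x
even⊎odd x with %ℕ2-cases x
... | inj₁ (_ , x≡) = inj₁ (even (x /ℕ 2) x≡)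
... | inj₂ (_ , x≡) = inj₂ (odd (x /ℕ 2) x≡)

%ℕ2≡1⇒odd : x %ℕ 2 ≡ 1 → Odd x
%ℕ2≡1⇒odd {x} x%2≡1 = odd (x /ℕ 2) (%ℕ≡⇒≡+* x%2≡1)

odd⇒%ℕ2≡1 : Odd x → x %ℕ 2 ≡ 1
odd⇒%ℕ2≡1 {x} x-odd with %ℕ2-cases x
... | inj₁ (_ , x≡)      = ⊥-elim (even⇒¬odd (even (x /ℕ 2) x≡) x-odd)
... | inj₂ (x%2≡1 , _)   = x%2≡1

2*-%ℕ2-/ℕ2 : x ≡ + 2 * y → x %ℕ 2 ≡ 0 × x /ℕ 2 ≡ y
2*-%ℕ2-/ℕ2 {x} {y} x≡2y with %ℕ2-cases x
... | inj₁ (x%2≡0 , x≡) = x%2≡0 , ℤ.*-cancelˡ-≡ (+ 2) (x /ℕ 2) y (trans (sym x≡) x≡2y)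
... | inj₂ (_ , x≡)     = ⊥-elim (even⇒¬odd (even y x≡2y) (odd (x /ℕ 2) x≡))

data Parity : ℕ → Set where
  2*_   : ∀ m → Parity (2 ℕ.* m)
  1+2*_ : ∀ m → Parity (1 ℕ.+ 2 ℕ.* m)

parity : ∀ k → Parity k
parity zero = 2* 0
parity (suc k) with parity k
... | 2* m   = 1+2* m
... | 1+2* m = subst Parity (ℕ.*-suc 2 m) (2* suc m)

odd-index : ∀ j → Odd (+ (1 ℕ.+ 2 ℕ.* j))
odd-index j = odd (+ j) (cong (_+_ (+ 1)) (ℤ.pos-* 2 j))

δE-even : ∀ m → δE (2 ℕ.* m) ≡ + 1
δE-even m rewrite trans (cong (ℕ._% 2) (ℕ.*-comm 2 m)) (m*n%n≡0 m 2) = refl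

δE-odd : ∀ m → δE (1 ℕ.+ 2 ℕ.* m) ≡ + 0
δE-odd m rewrite trans (cong (λ n → (1 ℕ.+ n) ℕ.% 2) (ℕ.*-comm 2 m)) ([m+kn]%n≡m%n 1 m 2) = refl

-- The 2-adic valuation

infix 4 _≡2^_*odd
record _≡2^_*odd (x : ℤ) (e : ℕ) : Set where
  constructor 2^-*odd
  field
    oddPart     : ℤ
    oddPart-odd : Odd oddPart
    x≡          : x ≡ + (2 ℕ.^ e) * oddPart

odd⇒≡2^0*odd : Odd x → x ≡2^ 0 *odd
odd⇒≡2^0*odd {x} x-odd = 2^-*odd x x-odd (sym (ℤ.*-identityˡ x))

≡2^1*odd⇒even : x ≡2^ 1 *odd → Even x
≡2^1*odd⇒even (2^-*odd o _ x≡) = even o x≡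

*-≡2^*odd : x ≡2^ e *odd → y ≡2^ f *odd → x * y ≡2^ (e ℕ.+ f) *odd
*-≡2^*odd {e = e} {f = f} (2^-*odd o o-odd refl) (2^-*odd o′ o′-odd refl) =
  2^-*odd (o * o′) (odd*odd o-odd o′-odd) (begin
    + (2 ℕ.^ e) * o * (+ (2 ℕ.^ f) * o′)
      ≡⟨ interchange (+ (2 ℕ.^ e)) o (+ (2 ℕ.^ f)) o′ ⟩
    + (2 ℕ.^ e) * + (2 ℕ.^ f) * (o * o′)
      ≡⟨ cong (_* (o * o′)) (ℤ.pos-* (2 ℕ.^ e) (2 ℕ.^ f)) ⟨
    + (2 ℕ.^ e ℕ.* 2 ℕ.^ f) * (o * o′)
      ≡⟨ cong (λ n → + n * (o * o′)) (ℕ.^-distribˡ-+-* 2 e f) ⟨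
    + (2 ℕ.^ (e ℕ.+ f)) * (o * o′)
      ∎)

2*-≡2^*odd : x ≡2^ e *odd → + 2 * x ≡2^ suc e *odd
2*-≡2^*odd = *-≡2^*odd (2^-*odd (+ 1) (odd (+ 0) refl) refl)

≡2^suc*odd⇒≡2* : x ≡2^ suc e *odd → ∃[ y ] y ≡2^ e *odd × x ≡ + 2 * y
≡2^suc*odd⇒≡2* {e = e} (2^-*odd o o-odd refl) =
  + (2 ℕ.^ e) * o , 2^-*odd o o-odd refl ,
  trans (cong (_* o) (ℤ.pos-* 2 (2 ℕ.^ e))) (ℤ.*-assoc (+ 2) (+ (2 ℕ.^ e)) o)

≡2^*odd⇒2^≤∣∣ : x ≡2^ e *odd → 2 ℕ.^ e ℕ.≤ ∣ x ∣
≡2^*odd⇒2^≤∣∣ {e = e} (2^-*odd o o-odd refl) =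
  subst (2 ℕ.^ e ℕ.≤_) (sym (ℤ.abs-* (+ (2 ℕ.^ e)) o))
    (ℕ.m≤m*n (2 ℕ.^ e) ∣ o ∣ {{ℕ.≢-nonZero (odd⇒≢0 o-odd ∘ ℤ.∣i∣≡0⇒i≡0)}})

≡2^*odd⇒≢0 : x ≡2^ e *odd → x ≢ + 0
≡2^*odd⇒≢0 {e = e} x≡ refl =
  ℕ.<-irrefl refl (ℕ.<-≤-trans (ℕ.m^n>0 2 e) (≡2^*odd⇒2^≤∣∣ x≡))

≢0⇒≡2^*odd : x ≢ + 0 → ∃[ e ] x ≡2^ e *odd
≢0⇒≡2^*odd {x} = go x (<-wellFounded ∣ x ∣)
  where
  go : ∀ x → Acc ℕ._<_ ∣ x ∣ → x ≢ + 0 → ∃[ e ] x ≡2^ e *odd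
  go x (acc rs) x≢0 with even⊎odd x
  ... | inj₂ x-odd = 0 , odd⇒≡2^0*odd x-odd
  ... | inj₁ (even q refl) with go q (rs ∣q∣<∣2q∣) q≢0
    where
    q≢0 : q ≢ + 0
    q≢0 refl = x≢0 refl
    ∣q∣<∣2q∣ : ∣ q ∣ ℕ.< ∣ + 2 * q ∣
    ∣q∣<∣2q∣ = subst (∣ q ∣ ℕ.<_) (trans (ℕ.*-comm ∣ q ∣ 2) (sym (ℤ.abs-* (+ 2) q)))
      (ℕ.m<m*n ∣ q ∣ 2 {{ℕ.≢-nonZero (q≢0 ∘ ℤ.∣i∣≡0⇒i≡0)}} (s≤s (s≤s z≤n)))
  ...   | e , q≡ = suc e , 2*-≡2^*odd q≡

n<2^n : ∀ n → n ℕ.< 2 ℕ.^ n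
n<2^n zero    = s≤s z≤n
n<2^n (suc n) = ℕ.<-≤-trans (s≤s (n<2^n n))
  (ℕ.m<m+n (2 ℕ.^ n) (ℕ.<-≤-trans (ℕ.m^n>0 2 n) (ℕ.m≤m+n (2 ℕ.^ n) 0)))

ν-aux-suc-odd : ∀ f {x} → x ≢ + 0 → x %ℕ 2 ≡ 1 → ν-aux (suc f) x ≡ fin (+ 0)
ν-aux-suc-odd f {+ zero}    x≢0 _     = ⊥-elim (x≢0 refl)
ν-aux-suc-odd f {+[1+ n ]}  _   x%2≡1 rewrite x%2≡1 = refl
ν-aux-suc-odd f { -[1+ n ]} _   x%2≡1 rewrite x%2≡1 = refl

ν-aux-suc-even : ∀ f {x} → x ≢ + 0 → x %ℕ 2 ≡ 0 →
                 ν-aux (suc f) x ≡ fin (+ 1) +∞ ν-aux f (x /ℕ 2)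
ν-aux-suc-even f {+ zero}    x≢0 _     = ⊥-elim (x≢0 refl)
ν-aux-suc-even f {+[1+ n ]}  _   x%2≡0 rewrite x%2≡0 = refl
ν-aux-suc-even f { -[1+ n ]} _   x%2≡0 rewrite x%2≡0 = refl

ν-aux-≡2^*odd : ∀ f → x ≡2^ e *odd → e ℕ.< f → ν-aux f x ≡ fin (+ e)
ν-aux-≡2^*odd {e = zero} (suc f) x≡@(2^-*odd o o-odd refl) _ =
  ν-aux-suc-odd f (≡2^*odd⇒≢0 x≡) (odd⇒%ℕ2≡1 (subst Odd (sym (ℤ.*-identityˡ o)) o-odd))
ν-aux-≡2^*odd {e = suc e} (suc f) x≡ (s≤s e<f) with ≡2^suc*odd⇒≡2* x≡
... | y , y≡ , refl with 2*-%ℕ2-/ℕ2 {y = y} refl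
...   | x%2≡0 , x/2≡y = begin
  ν-aux (suc f) (+ 2 * y)                ≡⟨ ν-aux-suc-even f (≡2^*odd⇒≢0 x≡) x%2≡0 ⟩
  fin (+ 1) +∞ ν-aux f (+ 2 * y /ℕ 2)    ≡⟨ cong (λ z → fin (+ 1) +∞ ν-aux f z) x/2≡y ⟩
  fin (+ 1) +∞ ν-aux f y                 ≡⟨ cong (fin (+ 1) +∞_) (ν-aux-≡2^*odd f y≡ e<f) ⟩
  fin (+ 1) +∞ fin (+ e)                 ∎

ν-≡2^*odd : x ≡2^ e *odd → ν x ≡ fin (+ e)
ν-≡2^*odd {x} {e} x≡ =
  ν-aux-≡2^*odd ∣ x ∣ x≡ (ℕ.<-≤-trans (n<2^n e) (≡2^*odd⇒2^≤∣∣ x≡))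

ν-odd : Odd x → ν x ≡ fin (+ 0)
ν-odd = ν-≡2^*odd ∘ odd⇒≡2^0*odd

+∞-comm : ∀ X Y → X +∞ Y ≡ Y +∞ X
+∞-comm (fin a) (fin b) = cong fin (ℤ.+-comm a b)
+∞-comm (fin a) ∞       = refl
+∞-comm ∞       (fin b) = refl
+∞-comm ∞       ∞       = refl

ν-* : ∀ x y → ν (x * y) ≡ ν x +∞ ν y
ν-* x y with x ℤ.≟ + 0 | y ℤ.≟ + 0
... | yes refl | _        = refl
... | no _     | yes refl = trans (cong ν (ℤ.*-zeroʳ x)) (+∞-comm ∞ (ν x))
... | no x≢0   | no y≢0   with ≢0⇒≡2^*odd x≢0 | ≢0⇒≡2^*odd y≢0
...   | e , x≡ | f , y≡ = trans (ν-≡2^*odd (*-≡2^*odd x≡ y≡))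
                                (sym (cong₂ _+∞_ (ν-≡2^*odd x≡) (ν-≡2^*odd y≡)))

ν-2* : ∀ x → ν (+ 2 * x) ≡ fin (+ 1) +∞ ν x
ν-2* = ν-* (+ 2)

δE-term-odd : ∀ j X → fin (+ 1) +∞ (δE (1 ℕ.+ 2 ℕ.* j) ·∞ X) ≡ fin (+ 1)
δE-term-odd j X =
  trans (cong (λ c → fin (+ 1) +∞ (c ·∞ X)) (δE-odd j)) (cong (fin (+ 1) +∞_) (0·∞ X))
  where
  0·∞ : ∀ X → (+ 0) ·∞ X ≡ fin (+ 0)
  0·∞ (fin a) = refl
  0·∞ ∞       = refl

δE-term-even : ∀ m x →
  fin (+ 1) +∞ (δE (2 ℕ.* m) ·∞ (ν (+ (2 ℕ.* m) * x) +∞ fin (- (+ 2)))) ≡ ν (+ m * x)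
δE-term-even m x = begin
  fin (+ 1) +∞ (δE (2 ℕ.* m) ·∞ (ν (+ (2 ℕ.* m) * x) +∞ fin (- (+ 2))))
    ≡⟨ cong (λ c → fin (+ 1) +∞ (c ·∞ (ν (+ (2 ℕ.* m) * x) +∞ fin (- (+ 2))))) (δE-even m) ⟩
  fin (+ 1) +∞ ((+ 1) ·∞ (ν (+ (2 ℕ.* m) * x) +∞ fin (- (+ 2))))
    ≡⟨ cong (fin (+ 1) +∞_) (1·∞ (ν (+ (2 ℕ.* m) * x) +∞ fin (- (+ 2)))) ⟩
  fin (+ 1) +∞ (ν (+ (2 ℕ.* m) * x) +∞ fin (- (+ 2)))
    ≡⟨ cong (λ z → fin (+ 1) +∞ (ν (z * x) +∞ fin (- (+ 2)))) (ℤ.pos-* 2 m) ⟩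
  fin (+ 1) +∞ (ν (+ 2 * + m * x) +∞ fin (- (+ 2)))
    ≡⟨ cong (λ z → fin (+ 1) +∞ (ν z +∞ fin (- (+ 2)))) (ℤ.*-assoc (+ 2) (+ m) x) ⟩
  fin (+ 1) +∞ (ν (+ 2 * (+ m * x)) +∞ fin (- (+ 2)))
    ≡⟨ cong (λ Y → fin (+ 1) +∞ (Y +∞ fin (- (+ 2)))) (ν-2* (+ m * x)) ⟩
  fin (+ 1) +∞ ((fin (+ 1) +∞ ν (+ m * x)) +∞ fin (- (+ 2)))
    ≡⟨ 1+[1+X-2]≡X (ν (+ m * x)) ⟩
  ν (+ m * x) ∎
  where
  1·∞ : ∀ X → (+ 1) ·∞ X ≡ X
  1·∞ (fin a) = cong fin (ℤ.*-identityˡ a)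
  1·∞ ∞       = refl
  1+[1+X-2]≡X : ∀ X → fin (+ 1) +∞ ((fin (+ 1) +∞ X) +∞ fin (- (+ 2))) ≡ X
  1+[1+X-2]≡X (fin a) = cong fin (solve (a ∷ []))
  1+[1+X-2]≡X ∞       = refl

-- Sections of the sequence

recurrence⇒lucas-multiple : ∀ (w : ℕ → ℤ) {c d} → w 0 ≡ + 0 →
  (∀ k → w (2 ℕ.+ k) ≡ c * w (1 ℕ.+ k) + d * w k) → ∀ k → w k ≡ w 1 * lucas c d k
recurrence⇒lucas-multiple w w₀ step zero       = trans w₀ (sym (ℤ.*-zeroʳ (w 1)))
recurrence⇒lucas-multiple w w₀ step (suc zero) = sym (ℤ.*-identityʳ (w 1))
recurrence⇒lucas-multiple w {c} {d} w₀ step (suc (suc k)) = begin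
  w (2 ℕ.+ k)                                                ≡⟨ step k ⟩
  c * w (1 ℕ.+ k) + d * w k
    ≡⟨ cong₂ (λ u v → c * u + d * v) (ih (suc k)) (ih k) ⟩
  c * (w 1 * lucas c d (1 ℕ.+ k)) + d * (w 1 * lucas c d k)  ≡⟨ factor (w 1) c d _ _ ⟩
  w 1 * lucas c d (2 ℕ.+ k)                                  ∎
  where
  ih : ∀ k → w k ≡ w 1 * lucas c d k
  ih = recurrence⇒lucas-multiple w w₀ step
  factor : ∀ w₁ c d u v → c * (w₁ * u) + d * (w₁ * v) ≡ w₁ * (c * u + d * v)
  factor = solve-∀

-- The indices are written d * 2 and d * 1 so that they compute to numerals for a numeral d.
lucas-section : ∀ s t d {c e} →
  (∀ n → lucas s t (d ℕ.* 2 ℕ.+ n) ≡ c * lucas s t (d ℕ.* 1 ℕ.+ n) + e * lucas s t n) →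
  ∀ k → lucas s t (d ℕ.* k) ≡ lucas s t (d ℕ.* 1) * lucas c e k
lucas-section s t d {c} {e} recurrence =
  recurrence⇒lucas-multiple (λ k → lucas s t (d ℕ.* k)) (cong (lucas s t) (ℕ.*-zeroʳ d)) step
  where
  step : ∀ k → lucas s t (d ℕ.* (2 ℕ.+ k))
             ≡ c * lucas s t (d ℕ.* (1 ℕ.+ k)) + e * lucas s t (d ℕ.* k)
  step k = begin
    lucas s t (d ℕ.* (2 ℕ.+ k))
      ≡⟨ cong (lucas s t) (ℕ.*-distribˡ-+ d 2 k) ⟩
    lucas s t (d ℕ.* 2 ℕ.+ d ℕ.* k)
      ≡⟨ recurrence (d ℕ.* k) ⟩
    c * lucas s t (d ℕ.* 1 ℕ.+ d ℕ.* k) + e * lucas s t (d ℕ.* k)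
      ≡⟨ cong (λ m → c * lucas s t m + e * lucas s t (d ℕ.* k)) (ℕ.*-distribˡ-+ d 1 k) ⟨
    c * lucas s t (d ℕ.* (1 ℕ.+ k)) + e * lucas s t (d ℕ.* k)
      ∎

lucas-4+ : ∀ a b n → lucas a b (4 ℕ.+ n)
                   ≡ (a * a + + 2 * b) * lucas a b (2 ℕ.+ n) + - (b * b) * lucas a b n
lucas-4+ a b n = four-steps a b (lucas a b n) (lucas a b (1 ℕ.+ n))
  where
  four-steps : ∀ a b x y →
    let y₂ = a * y + b * x; y₃ = a * y₂ + b * y; y₄ = a * y₃ + b * y₂
    in y₄ ≡ (a * a + + 2 * b) * y₂ + - (b * b) * x
  four-steps = solve-∀

lucas-6+ : ∀ s t n → lucas s t (6 ℕ.+ n)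
                   ≡ (s * s * s + + 3 * s * t) * lucas s t (3 ℕ.+ n) + t * t * t * lucas s t n
lucas-6+ s t n = six-steps s t (lucas s t n) (lucas s t (1 ℕ.+ n))
  where
  six-steps : ∀ s t x y →
    let y₂ = s * y + t * x; y₃ = s * y₂ + t * y; y₄ = s * y₃ + t * y₂
        y₅ = s * y₄ + t * y₃; y₆ = s * y₅ + t * y₄
    in y₆ ≡ (s * s * s + + 3 * s * t) * y₃ + t * t * t * x
  six-steps = solve-∀

lucas-2 : ∀ a b → lucas a b 2 ≡ a
lucas-2 a b = trans (cong₂ _+_ (ℤ.*-identityʳ a) (ℤ.*-zeroʳ b)) (ℤ.+-identityʳ a)

lucas-3 : ∀ s t → lucas s t 3 ≡ s * s + t
lucas-3 s t = cong₂ (λ u v → s * u + v) (lucas-2 s t) (ℤ.*-identityʳ t)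

lucas-2* : ∀ a b k → lucas a b (2 ℕ.* k) ≡ a * lucas (a * a + + 2 * b) (- (b * b)) k
lucas-2* a b k = trans (lucas-section a b 2 (lucas-4+ a b) k)
                       (cong (_* lucas (a * a + + 2 * b) (- (b * b)) k) (lucas-2 a b))

lucas-3* : ∀ s t k → lucas s t (3 ℕ.* k) ≡ lucas s t 3 * lucas (s * s * s + + 3 * s * t) (t * t * t) k
lucas-3* s t = lucas-section s t 3 (lucas-6+ s t)

lucas-parity-odd : Odd s → Odd t → ∀ k →
  Even (lucas s t (3 ℕ.* k)) × Odd (lucas s t (1 ℕ.+ 3 ℕ.* k)) × Odd (lucas s t (2 ℕ.+ 3 ℕ.* k))
lucas-parity-odd {s} {t} s-odd t-odd zero =
  even (+ 0) refl , odd (+ 0) refl , odd+even (odd*odd s-odd (odd (+ 0) refl)) (even*ʳ t (even (+ 0) refl))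
lucas-parity-odd {s} {t} s-odd t-odd (suc k) =
  subst Pattern (sym (ℕ.*-suc 3 k)) (step (3 ℕ.* k) (lucas-parity-odd s-odd t-odd k))
  where
  Pattern : ℕ → Set
  Pattern n = Even (lucas s t n) × Odd (lucas s t (1 ℕ.+ n)) × Odd (lucas s t (2 ℕ.+ n))
  step : ∀ n → Pattern n → Pattern (3 ℕ.+ n)
  step n (_ , o₁ , o₂) = e₃ , o₄ , odd+even (odd*odd s-odd o₄) (even*ʳ t e₃)
    where
    e₃ : Even (lucas s t (3 ℕ.+ n))
    e₃ = odd+odd (odd*odd s-odd o₂) (odd*odd t-odd o₁)
    o₄ : Odd (lucas s t (4 ℕ.+ n))
    o₄ = even+odd (even*ʳ s e₃) (odd*odd t-odd o₂)

lucas-parity-even : Even a → Odd b → ∀ m →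
  Even (lucas a b (2 ℕ.* m)) × Odd (lucas a b (1 ℕ.+ 2 ℕ.* m))
lucas-parity-even a-even b-odd zero = even (+ 0) refl , odd (+ 0) refl
lucas-parity-even {a} {b} a-even b-odd (suc m) =
  subst Pattern (sym (ℕ.*-suc 2 m)) (step (2 ℕ.* m) (lucas-parity-even a-even b-odd m))
  where
  Pattern : ℕ → Set
  Pattern n = Even (lucas a b n) × Odd (lucas a b (1 ℕ.+ n))
  step : ∀ n → Pattern n → Pattern (2 ℕ.+ n)
  step n (e₀ , o₁) = e₂ , even+odd (even*ˡ a-even (lucas a b (2 ℕ.+ n))) (odd*odd b-odd o₁)
    where
    e₂ : Even (lucas a b (2 ℕ.+ n))
    e₂ = even+even (even*ˡ a-even (lucas a b (1 ℕ.+ n))) (even*ʳ b e₀)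

even²+2*odd : Even a → Odd b → a * a + + 2 * b ≡2^ 1 *odd
even²+2*odd (even p refl) (odd q refl) =
  2^-*odd (+ 1 + + 2 * (p * p + q)) (odd (p * p + q) refl) (solve (p ∷ q ∷ []))

ν-lucas≡ν-index : ∀ k → 1 ℕ.≤ k → ∀ {a b} → a ≡2^ 1 *odd → Odd b →
                  ν (lucas a b k) ≡ ν (+ k)
ν-lucas≡ν-index = <-rec Claim go
  where
  Claim : ℕ → Set
  Claim k = 1 ℕ.≤ k → ∀ {a b} → a ≡2^ 1 *odd → Odd b → ν (lucas a b k) ≡ ν (+ k)
  go : ∀ k → (∀ {m} → m ℕ.< k → Claim m) → Claim k
  go k ih 1≤k {a} {b} a≡ b-odd with parity k
  ... | 1+2* j = trans (ν-odd (proj₂ (lucas-parity-even (≡2^1*odd⇒even a≡) b-odd j)))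
                       (sym (ν-odd (odd-index j)))
  ... | 2* zero = ⊥-elim (ℕ.<-irrefl refl 1≤k)
  ... | 2* suc m = begin
    ν (lucas a b (2 ℕ.* suc m))      ≡⟨ cong ν (lucas-2* a b (suc m)) ⟩
    ν (a * lucas a′ b′ (suc m))      ≡⟨ ν-* a (lucas a′ b′ (suc m)) ⟩
    ν a +∞ ν (lucas a′ b′ (suc m))
      ≡⟨ cong₂ _+∞_ (ν-≡2^*odd a≡) (ih m<k (s≤s z≤n) a′≡ b′-odd) ⟩
    fin (+ 1) +∞ ν (+ suc m)         ≡⟨ ν-2* (+ suc m) ⟨
    ν (+ 2 * + suc m)                ≡⟨ cong ν (ℤ.pos-* 2 (suc m)) ⟨
    ν (+ (2 ℕ.* suc m))              ∎
    where
    a′ b′ : ℤ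
    a′ = a * a + + 2 * b
    b′ = - (b * b)
    m<k : suc m ℕ.< 2 ℕ.* suc m
    m<k = ℕ.m<m+n (suc m) (s≤s z≤n)
    a′≡ : a′ ≡2^ 1 *odd
    a′≡ = even²+2*odd (≡2^1*odd⇒even a≡) b-odd
    b′-odd : Odd b′
    b′-odd = -odd (odd*odd b-odd b-odd)

-- The trisected sequence modulo 4

trisection-coeff-t≡3 : Odd s → ∀ q → t ≡ + 3 + + 4 * q → s * s * s + + 3 * s * t ≡2^ 1 *odd
trisection-coeff-t≡3 (odd p refl) q refl =
  2^-*odd ((+ 1 + + 2 * p) * (+ 1 + + 2 * (+ 2 + p + p * p + + 3 * q)))
          (odd*odd (odd p refl) (odd (+ 2 + p + p * p + + 3 * q) refl)) (solve (p ∷ q ∷ []))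

trisection-coeff-t≡1 : Odd s → ∀ q → t ≡ + 1 + + 4 * q → Even (s * s * s + + 3 * s * t)
trisection-coeff-t≡1 (odd p refl) q refl =
  even (+ 2 * (+ 1 + + 2 * p) * (+ 1 + p + p * p + + 3 * q)) (solve (p ∷ q ∷ []))

lucas-3-t≡1 : Odd s → ∀ q → t ≡ + 1 + + 4 * q → lucas s t 3 ≡2^ 1 *odd
lucas-3-t≡1 {s} {t} (odd p refl) q refl =
  2^-*odd (+ 1 + + 2 * (p + p * p + q)) (odd (p + p * p + q) refl) (trans (lucas-3 s t) (solve (p ∷ q ∷ [])))

module _ {s t : ℤ} (s-odd : Odd s) (t-odd : Odd t) where
  private
    A B : ℤ
    A = s * s * s + + 3 * s * t
    B = t * t * t
    B-odd : Odd B
    B-odd = odd*odd (odd*odd t-odd t-odd) t-odd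

  ν-lucas-3k+1 : ∀ k → ν (lucas s t (3 ℕ.* k ℕ.+ 1)) ≡ fin (+ 0)
  ν-lucas-3k+1 k = trans (cong (ν ∘ lucas s t) (ℕ.+-comm (3 ℕ.* k) 1))
                         (ν-odd (proj₁ (proj₂ (lucas-parity-odd s-odd t-odd k))))

  ν-lucas-3k+2 : ∀ k → ν (lucas s t (3 ℕ.* k ℕ.+ 2)) ≡ fin (+ 0)
  ν-lucas-3k+2 k = trans (cong (ν ∘ lucas s t) (ℕ.+-comm (3 ℕ.* k) 2))
                         (ν-odd (proj₂ (proj₂ (lucas-parity-odd s-odd t-odd k))))

  ν-lucas-3k : ∀ k → ν (lucas s t (3 ℕ.* k)) ≡ ν (lucas s t 3) +∞ ν (lucas A B k)
  ν-lucas-3k k = trans (cong ν (lucas-3* s t k)) (ν-* (lucas s t 3) (lucas A B k))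

  ν-lucas-3k-t≡3 : ∀ q → t ≡ + 3 + + 4 * q → ∀ k → 1 ℕ.≤ k →
    ν (lucas s t (3 ℕ.* k)) ≡ ν (+ k * lucas s t 3)
  ν-lucas-3k-t≡3 q t≡ k 1≤k = begin
    ν (lucas s t (3 ℕ.* k))              ≡⟨ ν-lucas-3k k ⟩
    ν (lucas s t 3) +∞ ν (lucas A B k)   ≡⟨ cong (ν (lucas s t 3) +∞_) ν-lucas-AB ⟩
    ν (lucas s t 3) +∞ ν (+ k)           ≡⟨ +∞-comm (ν (lucas s t 3)) (ν (+ k)) ⟩
    ν (+ k) +∞ ν (lucas s t 3)           ≡⟨ ν-* (+ k) (lucas s t 3) ⟨
    ν (+ k * lucas s t 3)                ∎
    where
    ν-lucas-AB : ν (lucas A B k) ≡ ν (+ k)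
    ν-lucas-AB = ν-lucas≡ν-index k 1≤k (trisection-coeff-t≡3 s-odd q t≡) B-odd

  lucas-6* : ∀ m → lucas s t (3 ℕ.* (2 ℕ.* m)) ≡ lucas s t 6 * lucas (A * A + + 2 * B) (- (B * B)) m
  lucas-6* m = begin
    lucas s t (3 ℕ.* (2 ℕ.* m))          ≡⟨ lucas-3* s t (2 ℕ.* m) ⟩
    lucas s t 3 * lucas A B (2 ℕ.* m)    ≡⟨ cong (lucas s t 3 *_) (lucas-2* A B m) ⟩
    lucas s t 3 * (A * L)                ≡⟨ ℤ.*-assoc (lucas s t 3) A L ⟨
    lucas s t 3 * A * L                  ≡⟨ cong (_* L) lucas-6 ⟨
    lucas s t 6 * L                      ∎
    where
    L : ℤ
    L = lucas (A * A + + 2 * B) (- (B * B)) m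
    lucas-6 : lucas s t 6 ≡ lucas s t 3 * A
    lucas-6 = trans (lucas-3* s t 2) (cong (lucas s t 3 *_) (lucas-2 A B))

  ν-lucas-3k-t≡1 : ∀ q → t ≡ + 1 + + 4 * q → ∀ k → 1 ℕ.≤ k →
    ν (lucas s t (3 ℕ.* k)) ≡ fin (+ 1) +∞ (δE k ·∞ (ν (+ k * lucas s t 6) +∞ fin (- (+ 2))))
  ν-lucas-3k-t≡1 q t≡ k 1≤k with parity k
  ... | 1+2* j = begin
    ν (lucas s t (3 ℕ.* k))              ≡⟨ ν-lucas-3k k ⟩
    ν (lucas s t 3) +∞ ν (lucas A B k)   ≡⟨ cong₂ _+∞_ ν-lucas-3 (ν-odd lucas-AB-odd) ⟩
    fin (+ 1)                            ≡⟨ δE-term-odd j _ ⟨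
    fin (+ 1) +∞ (δE k ·∞ (ν (+ k * lucas s t 6) +∞ fin (- (+ 2)))) ∎
    where
    ν-lucas-3 : ν (lucas s t 3) ≡ fin (+ 1)
    ν-lucas-3 = ν-≡2^*odd (lucas-3-t≡1 s-odd q t≡)
    lucas-AB-odd : Odd (lucas A B k)
    lucas-AB-odd = proj₂ (lucas-parity-even (trisection-coeff-t≡1 s-odd q t≡) B-odd j)
  ... | 2* zero = ⊥-elim (ℕ.<-irrefl refl 1≤k)
  ... | 2* m@(suc _) = begin
    ν (lucas s t (3 ℕ.* k))              ≡⟨ cong ν (lucas-6* m) ⟩
    ν (lucas s t 6 * L)                  ≡⟨ ν-* (lucas s t 6) L ⟩
    ν (lucas s t 6) +∞ ν L               ≡⟨ cong (ν (lucas s t 6) +∞_) ν-L ⟩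
    ν (lucas s t 6) +∞ ν (+ m)           ≡⟨ +∞-comm (ν (lucas s t 6)) (ν (+ m)) ⟩
    ν (+ m) +∞ ν (lucas s t 6)           ≡⟨ ν-* (+ m) (lucas s t 6) ⟨
    ν (+ m * lucas s t 6)                ≡⟨ δE-term-even m (lucas s t 6) ⟨
    fin (+ 1) +∞ (δE k ·∞ (ν (+ k * lucas s t 6) +∞ fin (- (+ 2)))) ∎
    where
    L : ℤ
    L = lucas (A * A + + 2 * B) (- (B * B)) m
    ν-L : ν L ≡ ν (+ m)
    ν-L = ν-lucas≡ν-index m (s≤s z≤n) (even²+2*odd (trisection-coeff-t≡1 s-odd q t≡) B-odd)
                          (-odd (odd*odd B-odd B-odd))

lemma3p1 : (s t : ℤ) → s %ℕ 2 ≡ 1 → t %ℕ 2 ≡ 1 →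
    ((k : ℕ) → (ν (lucas s t (3 ℕ.* k ℕ.+ 1)) ≡ fin (+ 0))
               × (ν (lucas s t (3 ℕ.* k ℕ.+ 2)) ≡ fin (+ 0)))
    × ((k : ℕ) → 1 ℕ.≤ k →
        (t %ℕ 4 ≡ 1 → ν (lucas s t (3 ℕ.* k))
            ≡ fin (+ 1) +∞ (δE k ·∞ (ν (+ k ℤ.* lucas s t 6) +∞ fin (- (+ 2)))))
        × (t %ℕ 4 ≡ 3 → ν (lucas s t (3 ℕ.* k)) ≡ ν (+ k ℤ.* lucas s t 3)))
lemma3p1 s t s%2≡1 t%2≡1 =
  (λ k → ν-lucas-3k+1 s-odd t-odd k , ν-lucas-3k+2 s-odd t-odd k) ,
  λ k 1≤k → (λ t%4≡1 → ν-lucas-3k-t≡1 s-odd t-odd (t /ℕ 4) (%ℕ≡⇒≡+* t%4≡1) k 1≤k)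
          , (λ t%4≡3 → ν-lucas-3k-t≡3 s-odd t-odd (t /ℕ 4) (%ℕ≡⇒≡+* t%4≡3) k 1≤k)
  where
  s-odd : Odd s
  s-odd = %ℕ2≡1⇒odd s%2≡1
  t-odd : Odd t
  t-odd = %ℕ2≡1⇒odd t%2≡1
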